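{- Let $H$ be a bipartite graph with bipartition $(A,B)$ such that every vertex in $A$ has degree two in $H$. Let $G$ be a graph with an induced minor isomorphic to $H$. Then there is an induced $H$-model $(X_v:v\in V(H))$ in $G$ such that $|V(X_a)|=1$ for all $a\in A$.
   Context: Graphs are finite and simple. For graphs $G,H$, an $H$-model in $G$ is a tuple $(X_v:v\in V(H))$ of pairwise disjoint non-null connected induced subgraphs of $G$ such that for every edge $uv\in E(H)$ some edge of $G$ joins $X_u$ and $X_v$; it is induced if, in addition, for all distinct nonadjacent $u,v\in V(H)$ there is no edge of $G$ between $X_u$ and $X_v$. $G$ has an induced minor isomorphic to $H$ (obtainable by deleting vertices and contracting edges) if and only if there is an induced $H$-model in $G$. -}

module Defs where

open import Data.Nat using (ℕ)
open import Data.Bool using (Bool; true; false; T)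
open import Data.Fin using (Fin)
open import Data.Fin.Subset using (Subset; _∈_; ∣_∣)
open import Data.Vec using (tabulate)
open import Data.Product using (Σ; ∃; _×_; _,_)
open import Relation.Binary.PropositionalEquality using (_≡_; _≢_)
open import Relation.Nullary using (¬_)

record Graph : Set where
  field
    n     : ℕ
    adj   : Fin n → Fin n → Bool
    sym   : ∀ x y → adj x y ≡ adj y x
    irref : ∀ x → adj x x ≡ false

open Graph public

V : Graph → Set
V G = Fin (n G)

Adj : (G : Graph) → V G → V G → Set
Adj G x y = T (adj G x y)

N : (G : Graph) → V G → Subset (n G)
N G v = tabulate (adj G v)

deg : (G : Graph) → V G → ℕ
deg G v = ∣ N G v ∣

data WalkIn (G : Graph) (S : Subset (n G)) : V G → V G → Set where
  here : ∀ {x} → x ∈ S → WalkIn G S x x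
  step : ∀ {x y z} → x ∈ S → Adj G x y → WalkIn G S y z → WalkIn G S x z

NonNullConnected : (G : Graph) → Subset (n G) → Set
NonNullConnected G S = (∃ λ x → x ∈ S) × (∀ x y → x ∈ S → y ∈ S → WalkIn G S x y)

Touch : (G : Graph) → Subset (n G) → Subset (n G) → Set
Touch G S T' = Σ (V G) λ x → Σ (V G) λ y → x ∈ S × y ∈ T' × Adj G x y

-- an H-model in G: branch sets X v (as vertex sets of induced subgraphs of G)
record IsModel (G H : Graph) (X : V H → Subset (n G)) : Set where
  field
    conn     : ∀ v → NonNullConnected G (X v)
    disjoint : ∀ u v → u ≢ v → ∀ x → x ∈ X u → ¬ (x ∈ X v)
    edges    : ∀ u v → Adj H u v → Touch G (X u) (X v)

record IsInducedModel (G H : Graph) (X : V H → Subset (n G)) : Set where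
  field
    model   : IsModel G H X
    nonedge : ∀ u v → u ≢ v → ¬ Adj H u v → ¬ Touch G (X u) (X v)

-- G has an induced minor isomorphic to H  iff  there is an induced H-model in G
HasInducedMinor : Graph → Graph → Set
HasInducedMinor G H = Σ (V H → Subset (n G)) (IsInducedModel G H)

IsBipartition : (H : Graph) → (V H → Bool) → Set
IsBipartition H inA = ∀ u v → Adj H u v → ¬ (inA u ≡ inA v)

{-# OPTIONS --safe #-}

-- The vertices of A are shrunk one at a time. Let a ∈ A have neighbours b₁ and b₂. Walk
-- inside the branch set X a from a vertex with a neighbour in X b₁ to a vertex with a
-- neighbour in X b₂, and let q be the first vertex of the walk with a neighbour in X b₂.
-- Move the vertices before q into X b₁ and shrink X a to {q}. Since the model is induced,
-- a moved vertex only sees the branch sets of a, b₁ and b₂, and by the choice of q not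
-- that of b₂; as a is adjacent to b₁, the new model is still induced. Only the branch sets
-- of a and b₁ change, and b₁ ∉ A, so branch sets shrunk earlier remain singletons.

module Submission where

open import Defs
open import Data.Nat.Properties using (suc-injective)
open import Data.Bool using (Bool; true; T)
import Data.Bool.Properties as Bool
open import Data.Product using (Σ; ∃; ∃₂; _×_; _,_; proj₁; proj₂)
open import Data.Sum using (_⊎_; inj₁; inj₂; map₂) renaming (map to ⊎-map)
open import Data.Empty using (⊥-elim)
open import Data.Fin using (zero; suc; _≟_)
open import Data.Fin.Properties using (any?)
open import Data.Fin.Subset using (Subset; _∈_; _⊆_; _∪_; ⁅_⁆; ∣_∣; Empty; inside; outside)
open import Data.Fin.Subset.Properties
  using (_∈?_; x∈⁅x⁆; x∈⁅y⁆⇒x≡y; ∣⁅x⁆∣≡1; p⊆p∪q; q⊆p∪q; x∈p∪q⁻; ⊆-reflexive)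
open import Data.Vec using (_∷_; here; there)
open import Data.Vec.Properties using (lookup∘tabulate; []=⇒lookup; lookup⇒[]=)
open import Data.Vec.Functional using (updateAt)
open import Data.Vec.Functional.Properties using (updateAt-updates; updateAt-minimal)
open import Data.List using (List; []; _∷_; allFin)
import Data.List.Relation.Unary.Any as Any
open import Data.List.Membership.Propositional using () renaming (_∈_ to _∈ˡ_)
open import Data.List.Membership.Propositional.Properties using (∈-allFin)
open import Function.Bundles using (Equivalence)
open import Relation.Nullary using (¬_; Dec; yes; no)
open import Relation.Nullary.Decidable using (_×-dec_; T?)
open import Relation.Unary using (Decidable)
open import Relation.Binary.PropositionalEquality using (_≡_; _≢_; refl; cong; subst; trans)
  renaming (sym to ≡-sym)

∣p∣≡0⇒Empty : ∀ {m} (p : Subset m) → ∣ p ∣ ≡ 0 → Empty p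
∣p∣≡0⇒Empty (inside ∷ p)  ()
∣p∣≡0⇒Empty (outside ∷ p) ∣p∣≡0 (suc x , there x∈p) = ∣p∣≡0⇒Empty p ∣p∣≡0 (x , x∈p)

∣p∣≡1⇒singleton : ∀ {m} (p : Subset m) → ∣ p ∣ ≡ 1 →
  ∃ λ x → x ∈ p × (∀ {z} → z ∈ p → z ≡ x)
∣p∣≡1⇒singleton (inside ∷ p) ∣p∣≡1 = zero , here , only-zero
  where
  only-zero : ∀ {z} → z ∈ inside ∷ p → z ≡ zero
  only-zero here        = refl
  only-zero (there z∈p) = ⊥-elim (∣p∣≡0⇒Empty p (suc-injective ∣p∣≡1) (_ , z∈p))
∣p∣≡1⇒singleton (outside ∷ p) ∣p∣≡1 with ∣p∣≡1⇒singleton p ∣p∣≡1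
... | x , x∈p , only-x = suc x , there x∈p , λ { (there z∈p) → cong suc (only-x z∈p) }

∣p∣≡2⇒pair : ∀ {m} (p : Subset m) → ∣ p ∣ ≡ 2 →
  ∃₂ λ x y → x ∈ p × y ∈ p × (∀ {z} → z ∈ p → z ≡ x ⊎ z ≡ y)
∣p∣≡2⇒pair (inside ∷ p) ∣p∣≡2 with ∣p∣≡1⇒singleton p (suc-injective ∣p∣≡2)
... | y , y∈p , only-y = zero , suc y , here , there y∈p , only-zero-y
  where
  only-zero-y : ∀ {z} → z ∈ inside ∷ p → z ≡ zero ⊎ z ≡ suc y
  only-zero-y here        = inj₁ refl
  only-zero-y (there z∈p) = inj₂ (cong suc (only-y z∈p))
∣p∣≡2⇒pair (outside ∷ p) ∣p∣≡2 with ∣p∣≡2⇒pair p ∣p∣≡2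
... | x , y , x∈p , y∈p , only-xy = suc x , suc y , there x∈p , there y∈p ,
  λ { (there z∈p) → ⊎-map (cong suc) (cong suc) (only-xy z∈p) }

Adj-sym : (G : Graph) {x y : V G} → Adj G x y → Adj G y x
Adj-sym G {x} {y} = subst T (sym G x y)

Adj-irrefl : (G : Graph) {x : V G} → ¬ Adj G x x
Adj-irrefl G {x} = subst T (irref G x)

∈N⇒Adj : (G : Graph) {v w : V G} → w ∈ N G v → Adj G v w
∈N⇒Adj G {v} {w} w∈N =
  Equivalence.from Bool.T-≡ (trans (≡-sym (lookup∘tabulate (adj G v) w)) ([]=⇒lookup w∈N))

Adj⇒∈N : (G : Graph) {v w : V G} → Adj G v w → w ∈ N G v
Adj⇒∈N G {v} {w} vw =
  lookup⇒[]= w (N G v) (trans (lookup∘tabulate (adj G v) w) (Equivalence.to Bool.T-≡ vw))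

deg≡2⇒neighbours : (H : Graph) {a : V H} → deg H a ≡ 2 →
  ∃₂ λ b₁ b₂ → Adj H a b₁ × Adj H a b₂ × (∀ {v} → Adj H a v → v ≡ b₁ ⊎ v ≡ b₂)
deg≡2⇒neighbours H {a} deg≡2 with ∣p∣≡2⇒pair (N H a) deg≡2
... | b₁ , b₂ , b₁∈N , b₂∈N , only =
  b₁ , b₂ , ∈N⇒Adj H b₁∈N , ∈N⇒Adj H b₂∈N , λ av → only (Adj⇒∈N H av)

AdjTo : (G : Graph) → V G → Subset (n G) → Set
AdjTo G x S = ∃ λ y → y ∈ S × Adj G x y

adjTo? : (G : Graph) (x : V G) (S : Subset (n G)) → Dec (AdjTo G x S)
adjTo? G x S = any? λ y → (y ∈? S) ×-dec T? (adj G x y)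

AdjTo⇒Touch : (G : Graph) {x : V G} {S T : Subset (n G)} → x ∈ S → AdjTo G x T → Touch G S T
AdjTo⇒Touch G x∈S (y , y∈T , xy) = _ , y , x∈S , y∈T , xy

Touch-sym : (G : Graph) {S T : Subset (n G)} → Touch G S T → Touch G T S
Touch-sym G (x , y , x∈S , y∈T , xy) = y , x , y∈T , x∈S , Adj-sym G xy

Touch-mono : (G : Graph) {S S′ T T′ : Subset (n G)} → S ⊆ S′ → T ⊆ T′ → Touch G S T → Touch G S′ T′
Touch-mono G S⊆S′ T⊆T′ (x , y , x∈S , y∈T , xy) = x , y , S⊆S′ x∈S , T⊆T′ y∈T , xy

module _ {G : Graph} where

  WalkIn-mono : ∀ {S S′ x y} → S ⊆ S′ → WalkIn G S x y → WalkIn G S′ x y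
  WalkIn-mono S⊆S′ (here x∈S)         = here (S⊆S′ x∈S)
  WalkIn-mono S⊆S′ (step x∈S xy walk) = step (S⊆S′ x∈S) xy (WalkIn-mono S⊆S′ walk)

  _++ʷ_ : ∀ {S x y z} → WalkIn G S x y → WalkIn G S y z → WalkIn G S x z
  here _            ++ʷ walk′ = walk′
  step x∈S xy walk ++ʷ walk′ = step x∈S xy (walk ++ʷ walk′)

  hub⇒connected : ∀ {S r} → r ∈ S →
    (∀ {z} → z ∈ S → WalkIn G S z r × WalkIn G S r z) → NonNullConnected G S
  hub⇒connected r∈S walks =
    (_ , r∈S) , λ x y x∈S y∈S → proj₁ (walks x∈S) ++ʷ proj₂ (walks y∈S)

  ⁅⁆-connected : (x : V G) → NonNullConnected G ⁅ x ⁆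
  ⁅⁆-connected x = hub⇒connected (x∈⁅x⁆ x) walks
    where
    walks : ∀ {z} → z ∈ ⁅ x ⁆ → WalkIn G ⁅ x ⁆ z x × WalkIn G ⁅ x ⁆ x z
    walks z∈⁅x⁆ with refl ← x∈⁅y⁆⇒x≡y x z∈⁅x⁆ = here (x∈⁅x⁆ x) , here (x∈⁅x⁆ x)

  ∪⁅⁆-connected : ∀ {B x} → NonNullConnected G B → AdjTo G x B → NonNullConnected G (B ∪ ⁅ x ⁆)
  ∪⁅⁆-connected {B} {x} (_ , walksB) (b , b∈B , xb) = hub⇒connected (B⊆ b∈B) walks
    where
    B⊆ : B ⊆ B ∪ ⁅ x ⁆
    B⊆ = p⊆p∪q ⁅ x ⁆
    x∈ : x ∈ B ∪ ⁅ x ⁆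
    x∈ = q⊆p∪q B ⁅ x ⁆ (x∈⁅x⁆ x)
    walks : ∀ {z} → z ∈ B ∪ ⁅ x ⁆ → WalkIn G (B ∪ ⁅ x ⁆) z b × WalkIn G (B ∪ ⁅ x ⁆) b z
    walks {z} z∈ with x∈p∪q⁻ B ⁅ x ⁆ z∈
    ... | inj₁ z∈B = WalkIn-mono B⊆ (walksB z b z∈B b∈B) , WalkIn-mono B⊆ (walksB b z b∈B z∈B)
    ... | inj₂ z∈⁅x⁆ with refl ← x∈⁅y⁆⇒x≡y x z∈⁅x⁆ =
      step x∈ xb (here (B⊆ b∈B)) , step (B⊆ b∈B) (Adj-sym G xb) (here x∈)

  record Absorption (S B T : Subset (n G)) : Set where
    field
      B⁺           : Subset (n G)
      q            : V G
      B⊆B⁺         : B ⊆ B⁺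
      B⁺-new       : ∀ {z} → z ∈ B⁺ → z ∈ B ⊎ (z ∈ S × ¬ AdjTo G z T)
      B⁺-connected : NonNullConnected G B⁺
      q∈S          : q ∈ S
      q~B⁺         : AdjTo G q B⁺
      q~T          : AdjTo G q T

  absorb-nothing : ∀ {S B T q} → NonNullConnected G B → q ∈ S → AdjTo G q B → AdjTo G q T →
    Absorption S B T
  absorb-nothing {q = q} B-connected q∈S q~B q~T = record
    { B⁺ = _ ; q = q ; B⊆B⁺ = λ z∈B → z∈B ; B⁺-new = inj₁ ; B⁺-connected = B-connected
    ; q∈S = q∈S ; q~B⁺ = q~B ; q~T = q~T }

  absorb-walk : ∀ {S B T x y} → NonNullConnected G B → WalkIn G S x y →
    AdjTo G x B → AdjTo G y T → Absorption S B T
  absorb-walk B-connected (here x∈S) x~B x~T = absorb-nothing B-connected x∈S x~B x~T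
  absorb-walk {S} {B} {T} {x} B-connected (step x∈S xy walk) x~B z~T with adjTo? G x T
  ... | yes x~T = absorb-nothing B-connected x∈S x~B x~T
  ... | no x≁T  = record
    { B⁺ = B⁺ ; q = q ; B⊆B⁺ = λ z∈B → B⊆B⁺ (p⊆p∪q ⁅ x ⁆ z∈B) ; B⁺-new = new
    ; B⁺-connected = B⁺-connected ; q∈S = q∈S ; q~B⁺ = q~B⁺ ; q~T = q~T }
    where
    rest : Absorption S (B ∪ ⁅ x ⁆) T
    rest = absorb-walk (∪⁅⁆-connected B-connected x~B) walk
             (x , q⊆p∪q B ⁅ x ⁆ (x∈⁅x⁆ x) , Adj-sym G xy) z~T
    open Absorption rest
    new : ∀ {z} → z ∈ B⁺ → z ∈ B ⊎ (z ∈ S × ¬ AdjTo G z T)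
    new z∈B⁺ with B⁺-new z∈B⁺
    ... | inj₂ fresh = inj₂ fresh
    ... | inj₁ z∈B∪x with x∈p∪q⁻ B ⁅ x ⁆ z∈B∪x
    ...   | inj₁ z∈B = inj₁ z∈B
    ...   | inj₂ z∈⁅x⁆ with refl ← x∈⁅y⁆⇒x≡y x z∈⁅x⁆ = inj₂ (x∈S , x≁T)

  absorb : ∀ {S B T} → NonNullConnected G S → NonNullConnected G B →
    Touch G S B → Touch G S T → Absorption S B T
  absorb (_ , walksS) B-connected (x , y , x∈S , y∈B , xy) (x′ , y′ , x′∈S , y′∈T , x′y′) =
    absorb-walk B-connected (walksS x x′ x∈S x′∈S) (y , y∈B , xy) (y′ , y′∈T , x′y′)

module ShrinkBranchSet {G H : Graph} {X : V H → Subset (n G)} (M : IsInducedModel G H X)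
  {a b₁ b₂ : V H} (ab₁ : Adj H a b₁) (ab₂ : Adj H a b₂)
  (N[a]⊆ : ∀ {v} → Adj H a v → v ≡ b₁ ⊎ v ≡ b₂) where

  open IsInducedModel M
  open IsModel model
  open Absorption (absorb (conn a) (conn b₁) (edges a b₁ ab₁) (edges a b₂ ab₂))

  Y : V H → Subset (n G)
  Y = updateAt (updateAt X b₁ λ _ → B⁺) a λ _ → ⁅ q ⁆

  b₁≢a : b₁ ≢ a
  b₁≢a refl = Adj-irrefl H ab₁

  Y-a : Y a ≡ ⁅ q ⁆
  Y-a = updateAt-updates a _

  Y-b₁ : Y b₁ ≡ B⁺
  Y-b₁ = trans (updateAt-minimal b₁ a _ b₁≢a) (updateAt-updates b₁ X)

  Y-other : ∀ {v} → v ≢ a → v ≢ b₁ → Y v ≡ X v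
  Y-other {v} v≢a v≢b₁ = trans (updateAt-minimal v a _ v≢a) (updateAt-minimal v b₁ X v≢b₁)

  ∈Y-a : ∀ {x} → x ∈ Y a → x ≡ q
  ∈Y-a x∈ = x∈⁅y⁆⇒x≡y q (⊆-reflexive Y-a x∈)

  q∈Y-a : q ∈ Y a
  q∈Y-a = ⊆-reflexive (≡-sym Y-a) (x∈⁅x⁆ q)

  B⁺⊆Y-b₁ : B⁺ ⊆ Y b₁
  B⁺⊆Y-b₁ = ⊆-reflexive (≡-sym Y-b₁)

  X⊆Y : ∀ {v} → v ≢ a → X v ⊆ Y v
  X⊆Y {v} v≢a x∈ with v ≟ b₁
  ... | yes refl  = B⁺⊆Y-b₁ (B⊆B⁺ x∈)
  ... | no v≢b₁ = ⊆-reflexive (≡-sym (Y-other v≢a v≢b₁)) x∈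

  Fresh : V G → Set
  Fresh x = x ∈ X a × ¬ AdjTo G x (X b₂)

  ∈Y : ∀ {v x} → x ∈ Y v → x ∈ X v ⊎ (v ≡ b₁ × Fresh x)
  ∈Y {v} x∈ with v ≟ a | v ≟ b₁
  ... | yes refl | _ with refl ← ∈Y-a x∈ = inj₁ q∈S
  ... | no _     | yes refl = map₂ (refl ,_) (B⁺-new (⊆-reflexive Y-b₁ x∈))
  ... | no v≢a   | no v≢b₁ = inj₁ (⊆-reflexive (Y-other v≢a v≢b₁) x∈)

  fresh∈Y⇒∉X : ∀ {u x} → Fresh x → x ∈ Y u → ¬ x ∈ X u
  fresh∈Y⇒∉X {u} (x∈Xa , x≁Xb₂) x∈Yu x∈Xu with u ≟ a
  ... | yes refl with refl ← ∈Y-a x∈Yu = x≁Xb₂ q~T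
  ... | no u≢a = disjoint u a u≢a _ x∈Xu x∈Xa

  -- A fresh vertex lies in X a, so it only sees X a, X b₁ and X b₂; X b₂ is excluded by freshness.
  fresh-isolated : ∀ {u x y} → u ≢ b₁ → ¬ Adj H u b₁ → x ∈ X u → Fresh y → ¬ Adj G x y
  fresh-isolated {u} {x} {y} u≢b₁ ¬ub₁ x∈Xu (y∈Xa , y≁Xb₂) xy with u ≟ a | u ≟ b₂
  ... | yes refl | _        = ¬ub₁ ab₁
  ... | no _     | yes refl = y≁Xb₂ (x , x∈Xu , Adj-sym G xy)
  ... | no u≢a   | no u≢b₂ = nonedge u a u≢a ¬ua (x , y , x∈Xu , y∈Xa , xy)
    where
    ¬ua : ¬ Adj H u a
    ¬ua ua with N[a]⊆ (Adj-sym H ua)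
    ... | inj₁ u≡b₁ = u≢b₁ u≡b₁
    ... | inj₂ u≡b₂ = u≢b₂ u≡b₂

  Y-connected : ∀ v → NonNullConnected G (Y v)
  Y-connected v with v ≟ a | v ≟ b₁
  ... | yes refl | _        = subst (NonNullConnected G) (≡-sym Y-a) (⁅⁆-connected q)
  ... | no _     | yes refl = subst (NonNullConnected G) (≡-sym Y-b₁) B⁺-connected
  ... | no v≢a   | no v≢b₁ = subst (NonNullConnected G) (≡-sym (Y-other v≢a v≢b₁)) (conn v)

  Y-disjoint : ∀ u v → u ≢ v → ∀ x → x ∈ Y u → ¬ x ∈ Y v
  Y-disjoint u v u≢v x x∈Yu x∈Yv with ∈Y x∈Yu | ∈Y x∈Yv
  ... | inj₁ x∈Xu        | inj₁ x∈Xv        = disjoint u v u≢v x x∈Xu x∈Xv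
  ... | inj₁ x∈Xu        | inj₂ (_ , fresh) = fresh∈Y⇒∉X fresh x∈Yu x∈Xu
  ... | inj₂ (_ , fresh) | inj₁ x∈Xv        = fresh∈Y⇒∉X fresh x∈Yv x∈Xv
  ... | inj₂ (refl , _)  | inj₂ (refl , _)  = u≢v refl

  a-touches : ∀ {v} → Adj H a v → Touch G (Y a) (Y v)
  a-touches av with N[a]⊆ av
  ... | inj₁ refl = Touch-mono G (λ z∈ → z∈) B⁺⊆Y-b₁ (AdjTo⇒Touch G q∈Y-a q~B⁺)
  ... | inj₂ refl = Touch-mono G (λ z∈ → z∈) (X⊆Y b₂≢a) (AdjTo⇒Touch G q∈Y-a q~T)
    where
    b₂≢a : b₂ ≢ a
    b₂≢a refl = Adj-irrefl H ab₂

  Y-edges : ∀ u v → Adj H u v → Touch G (Y u) (Y v)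
  Y-edges u v uv with u ≟ a | v ≟ a
  ... | yes refl | _        = a-touches uv
  ... | no _     | yes refl = Touch-sym G (a-touches (Adj-sym H uv))
  ... | no u≢a   | no v≢a   = Touch-mono G (X⊆Y u≢a) (X⊆Y v≢a) (edges u v uv)

  Y-nonedge : ∀ u v → u ≢ v → ¬ Adj H u v → ¬ Touch G (Y u) (Y v)
  Y-nonedge u v u≢v ¬uv (x , y , x∈Yu , y∈Yv , xy) with ∈Y x∈Yu | ∈Y y∈Yv
  ... | inj₁ x∈Xu           | inj₁ y∈Xv           = nonedge u v u≢v ¬uv (x , y , x∈Xu , y∈Xv , xy)
  ... | inj₁ x∈Xu           | inj₂ (refl , fresh) = fresh-isolated u≢v ¬uv x∈Xu fresh xy
  ... | inj₂ (refl , fresh) | inj₁ y∈Xv           =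
    fresh-isolated (λ v≡u → u≢v (≡-sym v≡u)) (λ vu → ¬uv (Adj-sym H vu)) y∈Xv fresh (Adj-sym G xy)
  ... | inj₂ (refl , _)     | inj₂ (refl , _)     = u≢v refl

  Y-induced : IsInducedModel G H Y
  Y-induced = record
    { model   = record { conn = Y-connected ; disjoint = Y-disjoint ; edges = Y-edges }
    ; nonedge = Y-nonedge }

  ∣Y-a∣≡1 : ∣ Y a ∣ ≡ 1
  ∣Y-a∣≡1 = trans (cong ∣_∣ Y-a) (∣⁅x⁆∣≡1 q)

  Y-unchanged : ∀ {v} → v ≢ a → ¬ Adj H a v → Y v ≡ X v
  Y-unchanged v≢a ¬av = Y-other v≢a λ { refl → ¬av ab₁ }

shrink-deg-2-branch-set : ∀ {G H X} → IsInducedModel G H X → ∀ {a} → deg H a ≡ 2 →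
  Σ (V H → Subset (n G)) λ Y →
    IsInducedModel G H Y × ∣ Y a ∣ ≡ 1 × (∀ {v} → v ≢ a → ¬ Adj H a v → Y v ≡ X v)
shrink-deg-2-branch-set {H = H} M deg≡2 with deg≡2⇒neighbours H deg≡2
... | _ , _ , ab₁ , ab₂ , N[a]⊆ = Y , Y-induced , ∣Y-a∣≡1 , Y-unchanged
  where open ShrinkBranchSet M ab₁ ab₂ N[a]⊆

module _ {G H : Graph} {P : V H → Set} (P? : Decidable P)
  (P-stable : ∀ {u v} → P u → P v → ¬ Adj H u v) (P-deg : ∀ a → P a → deg H a ≡ 2) where

  singleton-branch-sets : HasInducedMinor G H → (L : List (V H)) →
    Σ (V H → Subset (n G)) λ X →
      IsInducedModel G H X × (∀ {a} → a ∈ˡ L → P a → ∣ X a ∣ ≡ 1)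
  singleton-branch-sets (X , M) [] = X , M , λ ()
  singleton-branch-sets minor (a ∷ L) with singleton-branch-sets minor L | P? a
  ... | X , M , X-L | no ¬Pa =
    X , M , λ { (Any.here refl) Pa → ⊥-elim (¬Pa Pa) ; (Any.there a′∈L) → X-L a′∈L }
  ... | X , M , X-L | yes Pa with shrink-deg-2-branch-set M (P-deg a Pa)
  ...   | Y , M′ , ∣Ya∣≡1 , unchanged = Y , M′ , Y-L
    where
    Y-L : ∀ {a′} → a′ ∈ˡ a ∷ L → P a′ → ∣ Y a′ ∣ ≡ 1
    Y-L (Any.here refl) _ = ∣Ya∣≡1
    Y-L {a′} (Any.there a′∈L) Pa′ with a′ ≟ a
    ... | yes refl = ∣Ya∣≡1
    ... | no a′≢a  = trans (cong ∣_∣ (unchanged a′≢a (P-stable Pa Pa′))) (X-L a′∈L Pa′)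

lemma5p10 : (H : Graph) (inA : V H → Bool) → IsBipartition H inA →
    (∀ a → inA a ≡ true → deg H a ≡ 2) →
    (G : Graph) → HasInducedMinor G H →
    Σ (V H → Subset (n G)) λ X →
      IsInducedModel G H X × (∀ a → inA a ≡ true → ∣ X a ∣ ≡ 1)
lemma5p10 H inA bip deg2 G minor =
  let X , M , X-A = singleton-branch-sets (λ a → inA a Bool.≟ true) A-stable deg2 minor (allFin (n H))
  in X , M , λ a a∈A → X-A (∈-allFin a) a∈A
  where
  A-stable : ∀ {u v} → inA u ≡ true → inA v ≡ true → ¬ Adj H u v
  A-stable u∈A v∈A uv = bip _ _ uv (trans u∈A (≡-sym v∈A))
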